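{- Let $C$ be a self-dual linear Kleinian code of length $n$ and $C'$ its shadow. If $W_C(u,v)=P_C(W_{\gamma_1},W_{\epsilon_2})=Q_C(W_{\gamma_1},W_{\epsilon_2}-W_{\gamma_1^2})$ with weighted homogeneous polynomials $P_C(x,y)$, $Q_C(x,y)$, then $$W_{C'}(u,v)=P_C(W_{\gamma_1'},W_{\epsilon_2})=Q_C(W_{\gamma_1'},W_{\epsilon_2}-W_{{\gamma_1'}^2}),$$ where $W_{\gamma_1}=u+v$, $W_{\gamma_1^2}=(u+v)^2$, $W_{\epsilon_2}=u^2+3v^2$, $W_{\gamma_1'}=2v$ and $W_{{\gamma_1'}^2}=4v^2$.
   Context: Let $K=\{0,a,b,c\}$ be the Kleinian four-group. A linear code of length $n$ is a subgroup $C\subseteq K^n$; $\mathrm{wt}(\mathbf{x})$ is the number of nonzero coordinates. Define $x\cdot y\in\mathbb{F}_2$ for $x,y\in K$ by $x\cdot y=1$ iff $x,y$ are nonzero and distinct; $(\mathbf{x},\mathbf{y})=\sum_ix_i\cdot y_i$; $C^\perp=\{\mathbf{x}:(\mathbf{x},\mathbf{y})=0\ \forall \mathbf{y}\in C\}$; $C$ is self-dual if $C=C^\perp$, even if all codewords have even weight. For any subset $S\subseteq K^n$, $W_S(u,v)=\sum_{\mathbf{x}\in S}u^{n-\mathrm{wt}(\mathbf{x})}v^{\mathrm{wt}(\mathbf{x})}$. For a self-dual code $C$, let $C_0$ be its subcode of even-weight codewords; the shadow is $C'=C_0^\perp\setminus C$ if $C$ is not even, and $C'=C$ if $C$ is even.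 Here $\gamma_1=\{(0),(a)\}$, $\epsilon_2=\{(0,0),(a,a),(b,b),(c,c)\}$, and $\gamma_1'=\{(b),(c)\}$ is the shadow of $\gamma_1$. Weighted homogeneity refers to giving the first variable weight $1$ and the second weight $2$. -}

module Defs where

open import Data.Bool using (Bool; true; false; _∧_; _∨_; not; _xor_; if_then_else_)
open import Data.Nat as ℕ using (ℕ; zero; suc; _∸_)
open import Data.Vec using (Vec; []; _∷_; zipWith; replicate)
open import Data.List using (List; []; _∷_; map; concatMap; filter; foldr)
open import Data.List.Relation.Unary.All using (All)
open import Data.Product using (_×_; _,_)
open import Data.Sum using (_⊎_)
open import Data.Rational using (ℚ; 0ℚ; 1ℚ; _+_; _*_; _-_)
open import Relation.Binary.PropositionalEquality using (_≡_)
open import Relation.Nullary.Decidable using (does)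
open import Relation.Unary using (Pred)

data K : Set where
  𝟘 a b c : K

_⊕_ : K → K → K
𝟘 ⊕ y = y
x ⊕ 𝟘 = x
a ⊕ a = 𝟘
a ⊕ b = c
a ⊕ c = b
b ⊕ a = c
b ⊕ b = 𝟘
b ⊕ c = a
c ⊕ a = b
c ⊕ b = a
c ⊕ c = 𝟘

nonzero : K → Bool
nonzero 𝟘 = false
nonzero _ = true

-- x·y ∈ F₂ (F₂ = Bool, addition = xor): 1 iff x,y nonzero and distinct
_·_ : K → K → Bool
a · b = true
a · c = true
b · a = true
b · c = true
c · a = true
c · b = true
_ · _ = false

Word : ℕ → Set
Word n = Vec K n

_⊕ᵥ_ : ∀ {n} → Word n → Word n → Word n
_⊕ᵥ_ = zipWith _⊕_

0ᵥ : ∀ {n} → Word n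
0ᵥ = replicate _ 𝟘

wt : ∀ {n} → Word n → ℕ
wt [] = 0
wt (x ∷ xs) = if nonzero x then suc (wt xs) else wt xs

⟨_,_⟩ : ∀ {n} → Word n → Word n → Bool
⟨ [] , [] ⟩ = false
⟨ x ∷ xs , y ∷ ys ⟩ = (x · y) xor ⟨ xs , ys ⟩

isEven : ℕ → Bool
isEven zero = true
isEven (suc m) = not (isEven m)

allWords : (n : ℕ) → List (Word n)
allWords zero = [] ∷ []
allWords (suc n) =
  concatMap (λ x → map (x ∷_) (allWords n)) (𝟘 ∷ a ∷ b ∷ c ∷ [])

allW : ∀ {n} → (Word n → Bool) → Bool
allW {n} p = foldr (λ x r → p x ∧ r) true (allWords n)

Code : ℕ → Set
Code n = Word n → Bool

_∈C_ : ∀ {n} → Word n → Code n → Set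
x ∈C C = C x ≡ true

-- linear code = subgroup of K^n (every element has order ≤ 2, so
-- containing 0 and closure under ⊕ suffices)
record IsLinear {n : ℕ} (C : Code n) : Set where
  field
    has-zero : 0ᵥ ∈C C
    closed   : ∀ x y → x ∈C C → y ∈C C → (x ⊕ᵥ y) ∈C C

IsSelfDual : ∀ {n} → Code n → Set
IsSelfDual C = ∀ x → (x ∈C C → (∀ y → y ∈C C → ⟨ x , y ⟩ ≡ false))
                   × ((∀ y → y ∈C C → ⟨ x , y ⟩ ≡ false) → x ∈C C)

isEvenCode : ∀ {n} → Code n → Bool
isEvenCode C = allW (λ y → not (C y) ∨ isEven (wt y))

evenSubcode : ∀ {n} → Code n → Code n
evenSubcode C y = C y ∧ isEven (wt y)

dual : ∀ {n} → Code n → Code n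
dual D x = allW (λ y → not (D y) ∨ not ⟨ x , y ⟩)

shadow : ∀ {n} → Code n → Code n
shadow C x = if isEvenCode C then C x
             else (dual (evenSubcode C) x ∧ not (C x))

infixr 8 _^_
_^_ : ℚ → ℕ → ℚ
q ^ zero = 1ℚ
q ^ suc m = q * (q ^ m)

2ℚ 3ℚ 4ℚ : ℚ
2ℚ = 1ℚ + 1ℚ
3ℚ = 2ℚ + 1ℚ
4ℚ = 2ℚ + 2ℚ

W : ∀ {n} → Code n → ℚ → ℚ → ℚ
W {n} S u v =
  foldr (λ x r → (if S x then u ^ (n ∸ wt x) * v ^ wt x else 0ℚ) + r)
        0ℚ (allWords n)

-- Polynomials in two variables x,y over ℚ: finite lists of monomials
-- (coefficient, exponent of x, exponent of y)

Poly2 : Set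
Poly2 = List (ℚ × ℕ × ℕ)

eval : Poly2 → ℚ → ℚ → ℚ
eval P x y = foldr (λ { (q , i , j) r → q * (x ^ i) * (y ^ j) + r }) 0ℚ P

IsWeightedHomogeneous : ℕ → Poly2 → Set
IsWeightedHomogeneous d P =
  All (λ { (q , i , j) → q ≡ 0ℚ ⊎ i ℕ.+ 2 ℕ.* j ≡ d }) P

Wγ₁ Wγ₁² Wε₂ Wγ₁' Wγ₁'² : ℚ → ℚ → ℚ
Wγ₁ u v = u + v
Wγ₁² u v = (u + v) ^ 2
Wε₂ u v = u ^ 2 + 3ℚ * v ^ 2
Wγ₁' u v = 2ℚ * v
Wγ₁'² u v = 4ℚ * v ^ 2

-- The weight parity β(x) = wt x mod 2 is a quadratic form on Kⁿ whose polar form is the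
-- inner product.  Hence, for a self-dual code C and a word y, the map x ↦ β(x) + (x, y) is a
-- character of C, and it is trivial exactly when y lies in the shadow C′.  Substituting
-- u ↦ (u + 3v)/2, v ↦ (v − u)/2 into W_C and writing each letter as ½ times a signed sum
-- over K gives 2⁻ⁿ Σ_y u^(n − wt y) v^(wt y) Σ_{x ∈ C} (−1)^(β(x) + (x, y)); orthogonality
-- of characters and |C| = 2ⁿ (from |C|² = 4ⁿ, by the same orthogonality) turn this into
-- W_{C′}(u, v).  The substitution fixes W_{ε₂} and sends W_{γ₁}, W_{γ₁²} to W_{γ₁'},
-- W_{γ₁'²}, so both polynomial expressions for W_C transport to W_{C′}.

module Submission where

open import Defs
open import Data.Nat using (ℕ)
open import Data.Product using (_×_)
open import Relation.Binary.PropositionalEquality using (_≡_)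
open import Data.Rational using (ℚ; _-_)

open import Algebra.Bundles using (CommutativeRing; CommutativeMonoid)
open import Data.Empty using (⊥-elim)
open import Data.Bool using (Bool; true; false; not; _∧_; _∨_; _xor_; if_then_else_)
open import Data.Bool.Properties
  using (xor-∧-commutativeRing; xor-identityʳ; xor-same; ∧-conicalˡ; ∧-conicalʳ; T-≡; ⇔→≡)
  renaming (_≟_ to _≟ᵇ_)
open import Data.List using (List; []; _∷_; _++_; map; concat; foldr)
open import Data.List.Membership.Propositional using (_∈_)
open import Data.List.Membership.Propositional.Properties using (∈-map⁺; ∈-concat⁺′)
open import Data.List.Relation.Unary.Any using (here; there)
open import Data.Nat using (zero; suc; _∸_; z≤n; s≤s) renaming (_≤_ to _≤ⁿ_)
import Data.Nat.Properties as ℕ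
open import Data.Product using (_,_; proj₁; proj₂; ∃)
open import Data.Rational using (0ℚ; 1ℚ; _+_; _*_; -_; ½; _≤_; Positive; nonNegative)
import Data.Rational.Properties as ℚ
open import Data.Vec using ([]; _∷_)
open import Function.Bundles using (Equivalence; _⇔_; mk⇔)
open import Function.Properties.Equivalence using () renaming (trans to ⇔-trans)
open import Relation.Binary.Definitions using (tri<; tri≈; tri>)
open import Relation.Binary.PropositionalEquality
  using (refl; sym; trans; cong; cong₂; subst; module ≡-Reasoning)
open import Relation.Nullary.Decidable using (Dec; isYes; toWitness)
open import Data.Rational.Solver using (module +-*-Solver)

open import Algebra.Properties.CommutativeSemigroup
  (CommutativeRing.+-commutativeSemigroup xor-∧-commutativeRing)
  using () renaming (interchange to xor-interchange)
open import Algebra.Properties.CommutativeSemigroup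
  (CommutativeRing.+-commutativeSemigroup ℚ.+-*-commutativeRing)
  using () renaming (interchange to +-interchange)
open import Algebra.Properties.CommutativeSemigroup
  (CommutativeMonoid.commutativeSemigroup ℚ.*-1-commutativeMonoid)
  using (x∙yz≈y∙xz) renaming (interchange to *-interchange)

open +-*-Solver

not≡true⇒≡false : ∀ {p} → not p ≡ true → p ≡ false
not≡true⇒≡false {false} _ = refl

not≡false⇒≡true : ∀ {p} → not p ≡ false → p ≡ true
not≡false⇒≡true {true} _ = refl

≡false⇒not≡true : ∀ {p} → p ≡ false → not p ≡ true
≡false⇒not≡true refl = refl

xor≡false⇒≡ : ∀ p q → p xor q ≡ false → q ≡ p
xor≡false⇒≡ true  true  _ = refl
xor≡false⇒≡ false false _ = refl

every : {A : Set} → (A → Bool) → List A → Bool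
every p = foldr (λ x r → p x ∧ r) true

every-sound : {A : Set} (p : A → Bool) {x : A} {xs : List A} →
              x ∈ xs → every p xs ≡ true → p x ≡ true
every-sound p (here refl)  holds = ∧-conicalˡ _ _ holds
every-sound p (there x∈xs) holds = every-sound p x∈xs (∧-conicalʳ _ _ holds)

every-intro : {A : Set} (p : A → Bool) → (∀ x → p x ≡ true) →
              ∀ xs → every p xs ≡ true
every-intro p holds []       = refl
every-intro p holds (x ∷ xs) rewrite holds x = every-intro p holds xs

every-counterexample : {A : Set} (p : A → Bool) (xs : List A) →
                       every p xs ≡ false → ∃ λ x → p x ≡ false
every-counterexample p (x ∷ xs) fails with p x in px
... | false = x , px
... | true  = every-counterexample p xs fails

elemsK : List K
elemsK = 𝟘 ∷ a ∷ b ∷ c ∷ []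

∈-elemsK : ∀ k → k ∈ elemsK
∈-elemsK 𝟘 = here refl
∈-elemsK a = there (here refl)
∈-elemsK b = there (there (here refl))
∈-elemsK c = there (there (there (here refl)))

by-exhaustion₂ : {P : K → K → Set} (P? : ∀ k l → Dec (P k l)) →
                 every (λ k → every (λ l → isYes (P? k l)) elemsK) elemsK ≡ true →
                 ∀ k l → P k l
by-exhaustion₂ P? checked k l =
  toWitness (Equivalence.from T-≡ (every-sound (row k) (∈-elemsK l)
    (every-sound (λ k → every (row k) elemsK) (∈-elemsK k) checked)))
  where
  row : K → K → Bool
  row k l = isYes (P? k l)

by-exhaustion₃ : {P : K → K → K → Set} (P? : ∀ k l m → Dec (P k l m)) →
                 every (λ k → every (λ l → every (λ m → isYes (P? k l m)) elemsK) elemsK) elemsK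
                   ≡ true →
                 ∀ k l m → P k l m
by-exhaustion₃ P? checked k l m =
  by-exhaustion₂ (P? k)
    (every-sound (λ k → every (λ l → every (row k l) elemsK) elemsK) (∈-elemsK k) checked) l m
  where
  row : K → K → K → Bool
  row k l m = isYes (P? k l m)

⊕-cancelʳ : ∀ k l → (k ⊕ l) ⊕ l ≡ k
⊕-cancelʳ 𝟘 𝟘 = refl
⊕-cancelʳ 𝟘 a = refl
⊕-cancelʳ 𝟘 b = refl
⊕-cancelʳ 𝟘 c = refl
⊕-cancelʳ a 𝟘 = refl
⊕-cancelʳ a a = refl
⊕-cancelʳ a b = refl
⊕-cancelʳ a c = refl
⊕-cancelʳ b 𝟘 = refl
⊕-cancelʳ b a = refl
⊕-cancelʳ b b = refl
⊕-cancelʳ b c = refl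
⊕-cancelʳ c 𝟘 = refl
⊕-cancelʳ c a = refl
⊕-cancelʳ c b = refl
⊕-cancelʳ c c = refl

·-comm : ∀ k l → k · l ≡ l · k
·-comm = by-exhaustion₂ (λ k l → k · l ≟ᵇ l · k) refl

·-distribʳ-⊕ : ∀ k l m → (k ⊕ l) · m ≡ (k · m) xor (l · m)
·-distribʳ-⊕ = by-exhaustion₃ (λ k l m → (k ⊕ l) · m ≟ᵇ (k · m) xor (l · m)) refl

nonzero-⊕ : ∀ k l → nonzero (k ⊕ l) ≡ (nonzero k xor nonzero l) xor (k · l)
nonzero-⊕ =
  by-exhaustion₂ (λ k l → nonzero (k ⊕ l) ≟ᵇ (nonzero k xor nonzero l) xor (k · l)) refl

⊕ᵥ-cancelʳ : ∀ {n} (x y : Word n) → (x ⊕ᵥ y) ⊕ᵥ y ≡ x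
⊕ᵥ-cancelʳ []      []      = refl
⊕ᵥ-cancelʳ (k ∷ x) (l ∷ y) = cong₂ _∷_ (⊕-cancelʳ k l) (⊕ᵥ-cancelʳ x y)

⟨⟩-comm : ∀ {n} (x y : Word n) → ⟨ x , y ⟩ ≡ ⟨ y , x ⟩
⟨⟩-comm []      []      = refl
⟨⟩-comm (k ∷ x) (l ∷ y) = cong₂ _xor_ (·-comm k l) (⟨⟩-comm x y)

⟨⟩-linearˡ : ∀ {n} (x x′ y : Word n) → ⟨ x ⊕ᵥ x′ , y ⟩ ≡ ⟨ x , y ⟩ xor ⟨ x′ , y ⟩
⟨⟩-linearˡ []      []       []      = refl
⟨⟩-linearˡ (k ∷ x) (k′ ∷ x′) (l ∷ y) = begin
  ((k ⊕ k′) · l) xor ⟨ x ⊕ᵥ x′ , y ⟩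
    ≡⟨ cong₂ _xor_ (·-distribʳ-⊕ k k′ l) (⟨⟩-linearˡ x x′ y) ⟩
  ((k · l) xor (k′ · l)) xor (⟨ x , y ⟩ xor ⟨ x′ , y ⟩)
    ≡⟨ xor-interchange (k · l) (k′ · l) ⟨ x , y ⟩ ⟨ x′ , y ⟩ ⟩
  ((k · l) xor ⟨ x , y ⟩) xor ((k′ · l) xor ⟨ x′ , y ⟩)
    ∎
  where open ≡-Reasoning

parity : ∀ {n} → Word n → Bool
parity []      = false
parity (k ∷ x) = nonzero k xor parity x

isEven-wt : ∀ {n} (x : Word n) → isEven (wt x) ≡ not (parity x)
isEven-wt []      = refl
isEven-wt (𝟘 ∷ x) = isEven-wt x
isEven-wt (a ∷ x) = cong not (isEven-wt x)
isEven-wt (b ∷ x) = cong not (isEven-wt x)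
isEven-wt (c ∷ x) = cong not (isEven-wt x)

wt-even⇒parity≡false : ∀ {n} (x : Word n) → isEven (wt x) ≡ true → parity x ≡ false
wt-even⇒parity≡false x even = not≡true⇒≡false (trans (sym (isEven-wt x)) even)

wt-odd⇒parity≡true : ∀ {n} (x : Word n) → isEven (wt x) ≡ false → parity x ≡ true
wt-odd⇒parity≡true x odd = not≡false⇒≡true (trans (sym (isEven-wt x)) odd)

parity-⊕ᵥ : ∀ {n} (x y : Word n) → parity (x ⊕ᵥ y) ≡ (parity x xor parity y) xor ⟨ x , y ⟩
parity-⊕ᵥ []      []      = refl
parity-⊕ᵥ (k ∷ x) (l ∷ y) = begin
  nonzero (k ⊕ l) xor parity (x ⊕ᵥ y)
    ≡⟨ cong₂ _xor_ (nonzero-⊕ k l) (parity-⊕ᵥ x y) ⟩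
  ((nonzero k xor nonzero l) xor (k · l)) xor ((parity x xor parity y) xor ⟨ x , y ⟩)
    ≡⟨ xor-interchange (nonzero k xor nonzero l) (k · l) (parity x xor parity y) ⟨ x , y ⟩ ⟩
  ((nonzero k xor nonzero l) xor (parity x xor parity y)) xor ((k · l) xor ⟨ x , y ⟩)
    ≡⟨ cong (_xor ((k · l) xor ⟨ x , y ⟩)) (xor-interchange (nonzero k) (nonzero l) (parity x) (parity y)) ⟩
  ((nonzero k xor parity x) xor (nonzero l xor parity y)) xor ((k · l) xor ⟨ x , y ⟩)
    ∎
  where open ≡-Reasoning

wt≤n : ∀ {n} (x : Word n) → wt x ≤ⁿ n
wt≤n []      = z≤n
wt≤n (𝟘 ∷ x) = ℕ.m≤n⇒m≤1+n (wt≤n x)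
wt≤n (a ∷ x) = s≤s (wt≤n x)
wt≤n (b ∷ x) = s≤s (wt≤n x)
wt≤n (c ∷ x) = s≤s (wt≤n x)

∈-allWords : ∀ {n} (x : Word n) → x ∈ allWords n
∈-allWords []      = here refl
∈-allWords (k ∷ x) =
  ∈-concat⁺′ (∈-map⁺ (k ∷_) (∈-allWords x))
             (∈-map⁺ (λ l → map (l ∷_) (allWords _)) (∈-elemsK k))

module _ {n : ℕ} (P Q : Word n → Bool) where

  allW-⇒-sound : allW (λ x → not (P x) ∨ Q x) ≡ true → ∀ x → P x ≡ true → Q x ≡ true
  allW-⇒-sound holds x Px =
    subst (λ p → not p ∨ Q x ≡ true) Px (every-sound (λ x → not (P x) ∨ Q x) (∈-allWords x) holds)

  allW-⇒-intro : (∀ x → P x ≡ true → Q x ≡ true) → allW (λ x → not (P x) ∨ Q x) ≡ true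
  allW-⇒-intro P⇒Q = every-intro (λ x → not (P x) ∨ Q x) implication (allWords n)
    where
    implication : ∀ x → not (P x) ∨ Q x ≡ true
    implication x with P x in Px
    ... | false = refl
    ... | true  = P⇒Q x Px

  allW-⇒-counterexample : allW (λ x → not (P x) ∨ Q x) ≡ false → ∃ λ x → P x ≡ true × Q x ≡ false
  allW-⇒-counterexample fails with every-counterexample (λ x → not (P x) ∨ Q x) (allWords n) fails
  ... | x , ¬P∨Q≡false with P x in Px
  ...   | true = x , Px , ¬P∨Q≡false

∈-dual : ∀ {n} (D : Code n) (y : Word n) → (∀ z → z ∈C D → ⟨ y , z ⟩ ≡ false) → y ∈C dual D
∈-dual D y y⊥D =
  allW-⇒-intro D (λ z → not ⟨ y , z ⟩) (λ z z∈D → ≡false⇒not≡true (y⊥D z z∈D))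

dual-orthogonal : ∀ {n} (D : Code n) (y : Word n) →
                  y ∈C dual D → ∀ z → z ∈C D → ⟨ y , z ⟩ ≡ false
dual-orthogonal D y y∈D⊥ z z∈D =
  not≡true⇒≡false (allW-⇒-sound D (λ z → not ⟨ y , z ⟩) y∈D⊥ z z∈D)

-- Finite sums and products

∑ : {A : Set} → (A → ℚ) → List A → ℚ
∑ f = foldr (λ x r → f x + r) 0ℚ

∑-cong : {A : Set} {f g : A → ℚ} → (∀ x → f x ≡ g x) → ∀ xs → ∑ f xs ≡ ∑ g xs
∑-cong f≡g []       = refl
∑-cong f≡g (x ∷ xs) = cong₂ _+_ (f≡g x) (∑-cong f≡g xs)

∑-zero : {A : Set} (xs : List A) → ∑ (λ _ → 0ℚ) xs ≡ 0ℚ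
∑-zero []       = refl
∑-zero (x ∷ xs) = cong (0ℚ +_) (∑-zero xs)

∑-++ : {A : Set} (f : A → ℚ) (xs ys : List A) → ∑ f (xs ++ ys) ≡ ∑ f xs + ∑ f ys
∑-++ f []       ys = sym (ℚ.+-identityˡ _)
∑-++ f (x ∷ xs) ys = trans (cong (f x +_) (∑-++ f xs ys)) (sym (ℚ.+-assoc (f x) _ _))

∑-concat : {A : Set} (f : A → ℚ) (xss : List (List A)) → ∑ f (concat xss) ≡ ∑ (∑ f) xss
∑-concat f []         = refl
∑-concat f (xs ∷ xss) = trans (∑-++ f xs (concat xss)) (cong (∑ f xs +_) (∑-concat f xss))

∑-map : {A B : Set} (f : B → ℚ) (g : A → B) (xs : List A) → ∑ f (map g xs) ≡ ∑ (λ x → f (g x)) xs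
∑-map f g []       = refl
∑-map f g (x ∷ xs) = cong (f (g x) +_) (∑-map f g xs)

∑-+ : {A : Set} (f g : A → ℚ) (xs : List A) → ∑ (λ x → f x + g x) xs ≡ ∑ f xs + ∑ g xs
∑-+ f g []       = refl
∑-+ f g (x ∷ xs) =
  trans (cong (f x + g x +_) (∑-+ f g xs)) (+-interchange (f x) (g x) (∑ f xs) (∑ g xs))

∑-*ˡ : {A : Set} (q : ℚ) (f : A → ℚ) (xs : List A) → ∑ (λ x → q * f x) xs ≡ q * ∑ f xs
∑-*ˡ q f []       = sym (ℚ.*-zeroʳ q)
∑-*ˡ q f (x ∷ xs) = trans (cong (q * f x +_) (∑-*ˡ q f xs)) (sym (ℚ.*-distribˡ-+ q (f x) _))

∑-*ʳ : {A : Set} (f : A → ℚ) (q : ℚ) (xs : List A) → ∑ (λ x → f x * q) xs ≡ ∑ f xs * q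
∑-*ʳ f q []       = sym (ℚ.*-zeroˡ q)
∑-*ʳ f q (x ∷ xs) = trans (cong (f x * q +_) (∑-*ʳ f q xs)) (sym (ℚ.*-distribʳ-+ q (f x) _))

∑-comm : {A B : Set} (f : A → B → ℚ) (xs : List A) (ys : List B) →
         ∑ (λ x → ∑ (f x) ys) xs ≡ ∑ (λ y → ∑ (λ x → f x y) xs) ys
∑-comm f []       ys = sym (∑-zero ys)
∑-comm f (x ∷ xs) ys = trans (cong (∑ (f x) ys +_) (∑-comm f xs ys))
                              (sym (∑-+ (f x) (λ y → ∑ (λ x → f x y) xs) ys))

∑-if : {A : Set} (b : Bool) (f : A → ℚ) (xs : List A) →
       ∑ (λ x → if b then f x else 0ℚ) xs ≡ (if b then ∑ f xs else 0ℚ)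
∑-if true  f xs = refl
∑-if false f xs = ∑-zero xs

∑-nonneg : {A : Set} (f : A → ℚ) → (∀ x → 0ℚ ≤ f x) → ∀ xs → 0ℚ ≤ ∑ f xs
∑-nonneg f f≥0 []       = ℚ.≤-refl
∑-nonneg f f≥0 (x ∷ xs) = ℚ.+-mono-≤ (f≥0 x) (∑-nonneg f f≥0 xs)

*-if : ∀ q b r → q * (if b then r else 0ℚ) ≡ (if b then q * r else 0ℚ)
*-if q true  r = refl
*-if q false r = ℚ.*-zeroʳ q

if-*-comm : ∀ b p q → (if b then p * q else 0ℚ) ≡ q * (if b then p else 0ℚ)
if-*-comm true  p q = ℚ.*-comm p q
if-*-comm false p q = sym (ℚ.*-zeroʳ q)

∑K : (K → ℚ) → ℚ
∑K g = ∑ g elemsK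

∑ʷ : ∀ {n} → (Word n → ℚ) → ℚ
∑ʷ {n} f = ∑ f (allWords n)

∑ʷ-suc : ∀ {n} (f : Word (suc n) → ℚ) → ∑ʷ f ≡ ∑K (λ k → ∑ʷ (λ x → f (k ∷ x)))
∑ʷ-suc {n} f = begin
  ∑ f (concat (map rows elemsK))   ≡⟨ ∑-concat f (map rows elemsK) ⟩
  ∑ (∑ f) (map rows elemsK)        ≡⟨ ∑-map (∑ f) rows elemsK ⟩
  ∑K (λ k → ∑ f (rows k))          ≡⟨ ∑-cong (λ k → ∑-map f (k ∷_) (allWords n)) elemsK ⟩
  ∑K (λ k → ∑ʷ (λ x → f (k ∷ x)))  ∎
  where
  open ≡-Reasoning
  rows : K → List (Word (suc n))
  rows k = map (k ∷_) (allWords n)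

∑K-translate : (g : K → ℚ) (l : K) → ∑K (λ k → g (k ⊕ l)) ≡ ∑K g
∑K-translate g 𝟘 = refl
∑K-translate g a = swap₁₂-swap₃₄ (g 𝟘) (g a) (g b) (g c)
  where
  swap₁₂-swap₃₄ : ∀ p q r s → q + (p + (s + (r + 0ℚ))) ≡ p + (q + (r + (s + 0ℚ)))
  swap₁₂-swap₃₄ =
    solve 4 (λ p q r s → q :+ (p :+ (s :+ (r :+ con 0ℚ))) := p :+ (q :+ (r :+ (s :+ con 0ℚ)))) refl
∑K-translate g b = swap₁₃-swap₂₄ (g 𝟘) (g a) (g b) (g c)
  where
  swap₁₃-swap₂₄ : ∀ p q r s → r + (s + (p + (q + 0ℚ))) ≡ p + (q + (r + (s + 0ℚ)))
  swap₁₃-swap₂₄ =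
    solve 4 (λ p q r s → r :+ (s :+ (p :+ (q :+ con 0ℚ))) := p :+ (q :+ (r :+ (s :+ con 0ℚ)))) refl
∑K-translate g c = reverse₄ (g 𝟘) (g a) (g b) (g c)
  where
  reverse₄ : ∀ p q r s → s + (r + (q + (p + 0ℚ))) ≡ p + (q + (r + (s + 0ℚ)))
  reverse₄ =
    solve 4 (λ p q r s → s :+ (r :+ (q :+ (p :+ con 0ℚ))) := p :+ (q :+ (r :+ (s :+ con 0ℚ)))) refl

∑ʷ-translate : ∀ {n} (f : Word n → ℚ) (z : Word n) → ∑ʷ (λ x → f (x ⊕ᵥ z)) ≡ ∑ʷ f
∑ʷ-translate {zero}  f []      = refl
∑ʷ-translate {suc n} f (l ∷ z) = begin
  ∑ʷ (λ x → f (x ⊕ᵥ (l ∷ z)))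
    ≡⟨ ∑ʷ-suc (λ x → f (x ⊕ᵥ (l ∷ z))) ⟩
  ∑K (λ k → ∑ʷ (λ x → f ((k ⊕ l) ∷ (x ⊕ᵥ z))))
    ≡⟨ ∑-cong (λ k → ∑ʷ-translate (λ x → f ((k ⊕ l) ∷ x)) z) elemsK ⟩
  ∑K (λ k → ∑ʷ (λ x → f ((k ⊕ l) ∷ x)))
    ≡⟨ ∑K-translate (λ k → ∑ʷ (λ x → f (k ∷ x))) l ⟩
  ∑K (λ k → ∑ʷ (λ x → f (k ∷ x)))
    ≡⟨ sym (∑ʷ-suc f) ⟩
  ∑ʷ f
    ∎
  where open ≡-Reasoning

∏ : ∀ {n} → (K → ℚ) → Word n → ℚ
∏ h []      = 1ℚ
∏ h (k ∷ x) = h k * ∏ h x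

∏₂ : ∀ {n} → (K → K → ℚ) → Word n → Word n → ℚ
∏₂ g []      []      = 1ℚ
∏₂ g (k ∷ x) (l ∷ y) = g k l * ∏₂ g x y

∏-cong : ∀ {n} {h h′ : K → ℚ} → (∀ k → h k ≡ h′ k) → (x : Word n) → ∏ h x ≡ ∏ h′ x
∏-cong h≡h′ []      = refl
∏-cong h≡h′ (k ∷ x) = cong₂ _*_ (h≡h′ k) (∏-cong h≡h′ x)

∏-scale : ∀ {n} (q : ℚ) (h : K → ℚ) (x : Word n) → ∏ (λ k → q * h k) x ≡ q ^ n * ∏ h x
∏-scale q h []      = refl
∏-scale {suc n} q h (k ∷ x) =
  trans (cong (q * h k *_) (∏-scale q h x)) (*-interchange q (h k) (q ^ n) (∏ h x))

∑ʷ-∏₂ : ∀ {n} (g : K → K → ℚ) (x : Word n) → ∑ʷ (∏₂ g x) ≡ ∏ (λ k → ∑K (g k)) x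
∑ʷ-∏₂ g []      = ℚ.+-identityʳ 1ℚ
∑ʷ-∏₂ g (k ∷ x) = begin
  ∑ʷ (∏₂ g (k ∷ x))
    ≡⟨ ∑ʷ-suc (∏₂ g (k ∷ x)) ⟩
  ∑K (λ l → ∑ʷ (λ y → g k l * ∏₂ g x y))
    ≡⟨ ∑-cong (λ l → ∑-*ˡ (g k l) (∏₂ g x) (allWords _)) elemsK ⟩
  ∑K (λ l → g k l * ∑ʷ (∏₂ g x))
    ≡⟨ ∑-cong (λ l → cong (g k l *_) (∑ʷ-∏₂ g x)) elemsK ⟩
  ∑K (λ l → g k l * ∏ (λ k → ∑K (g k)) x)
    ≡⟨ ∑-*ʳ (g k) _ elemsK ⟩
  ∑K (g k) * ∏ (λ k → ∑K (g k)) x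
    ∎
  where open ≡-Reasoning

δ𝟘 : ℚ → K → ℚ
δ𝟘 q 𝟘 = q
δ𝟘 q a = 0ℚ
δ𝟘 q b = 0ℚ
δ𝟘 q c = 0ℚ

∑ʷ-∏-δ𝟘 : ∀ {n} (q : ℚ) (h : Word n → Bool) →
          ∑ʷ (λ x → if h x then ∏ (δ𝟘 q) x else 0ℚ) ≡ (if h 0ᵥ then q ^ n else 0ℚ)
∑ʷ-∏-δ𝟘 {zero}  q h = ℚ.+-identityʳ _
∑ʷ-∏-δ𝟘 {suc n} q h = begin
  ∑ʷ (λ x → if h x then ∏ (δ𝟘 q) x else 0ℚ)
    ≡⟨ ∑ʷ-suc (λ x → if h x then ∏ (δ𝟘 q) x else 0ℚ) ⟩
  ∑K (λ k → ∑ʷ (λ x → if h (k ∷ x) then δ𝟘 q k * ∏ (δ𝟘 q) x else 0ℚ))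
    ≡⟨ cong₂ _+_ at-𝟘 (cong₂ _+_ (off-𝟘 a) (cong₂ _+_ (off-𝟘 b) (cong₂ _+_ (off-𝟘 c) refl))) ⟩
  (if h 0ᵥ then q * q ^ n else 0ℚ) + (0ℚ + (0ℚ + (0ℚ + 0ℚ)))
    ≡⟨ ℚ.+-identityʳ _ ⟩
  (if h 0ᵥ then q ^ suc n else 0ℚ)
    ∎
  where
  open ≡-Reasoning
  at-𝟘 : ∑ʷ (λ x → if h (𝟘 ∷ x) then q * ∏ (δ𝟘 q) x else 0ℚ)
       ≡ (if h 0ᵥ then q * q ^ n else 0ℚ)
  at-𝟘 = begin
    ∑ʷ (λ x → if h (𝟘 ∷ x) then q * ∏ (δ𝟘 q) x else 0ℚ)
      ≡⟨ ∑-cong (λ x → sym (*-if q (h (𝟘 ∷ x)) _)) (allWords n) ⟩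
    ∑ʷ (λ x → q * (if h (𝟘 ∷ x) then ∏ (δ𝟘 q) x else 0ℚ))
      ≡⟨ ∑-*ˡ q (λ x → if h (𝟘 ∷ x) then ∏ (δ𝟘 q) x else 0ℚ) (allWords n) ⟩
    q * ∑ʷ (λ x → if h (𝟘 ∷ x) then ∏ (δ𝟘 q) x else 0ℚ)
      ≡⟨ cong (q *_) (∑ʷ-∏-δ𝟘 q (λ x → h (𝟘 ∷ x))) ⟩
    q * (if h 0ᵥ then q ^ n else 0ℚ)
      ≡⟨ *-if q (h 0ᵥ) _ ⟩
    (if h 0ᵥ then q * q ^ n else 0ℚ)
      ∎
  off-𝟘 : ∀ k → ∑ʷ (λ x → if h (k ∷ x) then 0ℚ * ∏ (δ𝟘 q) x else 0ℚ) ≡ 0ℚ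
  off-𝟘 k = trans (∑-cong (λ x → vanishing (h (k ∷ x)) (∏ (δ𝟘 q) x)) (allWords n))
                  (∑-zero (allWords n))
    where
    vanishing : ∀ b p → (if b then 0ℚ * p else 0ℚ) ≡ 0ℚ
    vanishing true  p = ℚ.*-zeroˡ p
    vanishing false p = refl

≡-neg⇒≡0 : ∀ s → s ≡ - s → s ≡ 0ℚ
≡-neg⇒≡0 s s≡-s = begin
  s              ≡⟨ halve s ⟩
  ½ * (s + s)    ≡⟨ cong (λ t → ½ * (s + t)) s≡-s ⟩
  ½ * (s + - s)  ≡⟨ cancel s ⟩
  0ℚ             ∎
  where
  open ≡-Reasoning
  halve : ∀ s → s ≡ ½ * (s + s)
  halve = solve 1 (λ s → s := con ½ :* (s :+ s)) refl
  cancel : ∀ s → ½ * (s + - s) ≡ 0ℚ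
  cancel = solve 1 (λ s → con ½ :* (s :+ :- s) := con 0ℚ) refl

square-injective : ∀ p q → 0ℚ ≤ p → Positive q → p * p ≡ q * q → p ≡ q
square-injective p q p≥0 q>0 p²≡q² with ℚ.<-cmp p q
... | tri≈ _ p≡q _ = p≡q
... | tri< p<q _ _ = ⊥-elim (ℚ.<-irrefl p²≡q²
      (ℚ.≤-<-trans (ℚ.*-monoˡ-≤-nonNeg p {{nonNegative p≥0}} (ℚ.<⇒≤ p<q))
                   (ℚ.*-monoˡ-<-pos q {{q>0}} p<q)))
... | tri> _ _ p>q = ⊥-elim (ℚ.<-irrefl (sym p²≡q²)
      (ℚ.<-≤-trans (ℚ.*-monoˡ-<-pos q {{q>0}} p>q)
                   (ℚ.*-monoˡ-≤-nonNeg p {{nonNegative p≥0}} (ℚ.<⇒≤ p>q))))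

2^n>0 : ∀ n → Positive (2ℚ ^ n)
2^n>0 zero    = _
2^n>0 (suc n) = ℚ.pos*pos⇒pos 2ℚ (2ℚ ^ n) {{2^n>0 n}}

4^n≡2^n*2^n : ∀ n → 4ℚ ^ n ≡ 2ℚ ^ n * 2ℚ ^ n
4^n≡2^n*2^n zero    = refl
4^n≡2^n*2^n (suc n) = trans (cong (4ℚ *_) (4^n≡2^n*2^n n)) (regroup (2ℚ ^ n))
  where
  regroup : ∀ t → 4ℚ * (t * t) ≡ 2ℚ * t * (2ℚ * t)
  regroup = solve 1 (λ t → con 4ℚ :* (t :* t) := con 2ℚ :* t :* (con 2ℚ :* t)) refl

½^n*[2^n*q]≡q : ∀ n q → ½ ^ n * (2ℚ ^ n * q) ≡ q
½^n*[2^n*q]≡q zero    q = trans (ℚ.*-identityˡ _) (ℚ.*-identityˡ q)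
½^n*[2^n*q]≡q (suc n) q = trans (regroup (½ ^ n) (2ℚ ^ n) q) (½^n*[2^n*q]≡q n q)
  where
  regroup : ∀ h t q → ½ * h * (2ℚ * t * q) ≡ h * (t * q)
  regroup = solve 3 (λ h t q → con ½ :* h :* (con 2ℚ :* t :* q) := h :* (t :* q)) refl

-- Characters of a linear code

sign : Bool → ℚ
sign false = 1ℚ
sign true  = - 1ℚ

sign-xor : ∀ p q → sign (p xor q) ≡ sign p * sign q
sign-xor true  true  = refl
sign-xor true  false = refl
sign-xor false true  = refl
sign-xor false false = refl

sign-flip : ∀ p → sign (p xor true) ≡ - 1ℚ * sign p
sign-flip true  = refl
sign-flip false = refl

sign-⟨⟩ : ∀ {n} (x y : Word n) → sign ⟨ x , y ⟩ ≡ ∏₂ (λ k l → sign (k · l)) x y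
sign-⟨⟩ []      []      = refl
sign-⟨⟩ (k ∷ x) (l ∷ y) = trans (sign-xor (k · l) ⟨ x , y ⟩) (cong (sign (k · l) *_) (sign-⟨⟩ x y))

∑K-sign-· : ∀ k → ∑K (λ l → sign (k · l)) ≡ δ𝟘 4ℚ k
∑K-sign-· 𝟘 = refl
∑K-sign-· a = refl
∑K-sign-· b = refl
∑K-sign-· c = refl

card : ∀ {n} → Code n → ℚ
card C = ∑ʷ (λ x → if C x then 1ℚ else 0ℚ)

IsHomomorphismOn : ∀ {n} → Code n → (Word n → Bool) → Set
IsHomomorphismOn C β = ∀ x y → x ∈C C → y ∈C C → β (x ⊕ᵥ y) ≡ β x xor β y

vanishesOn : ∀ {n} → Code n → (Word n → Bool) → Bool
vanishesOn C β = allW (λ x → not (C x) ∨ not (β x))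

module _ {n : ℕ} {C : Code n} (linear : IsLinear C)
         {β : Word n → Bool} (hom : IsHomomorphismOn C β) where
  open IsLinear linear

  -- Translating by a codeword on which β is nontrivial negates the sum.
  character-sum-nontrivial : ∀ x₀ → x₀ ∈C C → β x₀ ≡ true →
                             ∑ʷ (λ x → if C x then sign (β x) else 0ℚ) ≡ 0ℚ
  character-sum-nontrivial x₀ x₀∈C βx₀ = ≡-neg⇒≡0 (∑ʷ χ) (begin
    ∑ʷ χ                    ≡⟨ sym (∑ʷ-translate χ x₀) ⟩
    ∑ʷ (λ x → χ (x ⊕ᵥ x₀))  ≡⟨ ∑-cong flips (allWords n) ⟩
    ∑ʷ (λ x → - 1ℚ * χ x)   ≡⟨ ∑-*ˡ (- 1ℚ) χ (allWords n) ⟩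
    - 1ℚ * ∑ʷ χ             ≡⟨ minus-one (∑ʷ χ) ⟩
    - ∑ʷ χ                  ∎)
    where
    open ≡-Reasoning
    χ : Word n → ℚ
    χ x = if C x then sign (β x) else 0ℚ
    minus-one : ∀ s → - 1ℚ * s ≡ - s
    minus-one s = trans (sym (ℚ.neg-distribˡ-* 1ℚ s)) (cong -_ (ℚ.*-identityˡ s))
    flips : ∀ x → χ (x ⊕ᵥ x₀) ≡ - 1ℚ * χ x
    flips x with C x in x∈C
    ... | true rewrite closed x x₀ x∈C x₀∈C | hom x x₀ x∈C x₀∈C | βx₀ = sign-flip (β x)
    ... | false with C (x ⊕ᵥ x₀) in x⊕x₀∈C
    ...   | false = refl
    ...   | true
      with trans (sym (subst (λ z → C z ≡ true) (⊕ᵥ-cancelʳ x x₀) (closed _ _ x⊕x₀∈C x₀∈C))) x∈C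
    ...     | ()

  character-sum : ∑ʷ (λ x → if C x then sign (β x) else 0ℚ)
                ≡ (if vanishesOn C β then card C else 0ℚ)
  character-sum with vanishesOn C β in vanishes
  ... | true  = ∑-cong trivial (allWords n)
    where
    trivial : ∀ x → (if C x then sign (β x) else 0ℚ) ≡ (if C x then 1ℚ else 0ℚ)
    trivial x with C x in x∈C
    ... | false = refl
    ... | true  rewrite not≡true⇒≡false (allW-⇒-sound C (λ x → not (β x)) vanishes x x∈C) = refl
  ... | false with allW-⇒-counterexample C (λ x → not (β x)) vanishes
  ...   | x₀ , x₀∈C , ¬βx₀ = character-sum-nontrivial x₀ x₀∈C (not≡false⇒≡true ¬βx₀)

-- Self-dual codes and their shadows

shadowCharacter : ∀ {n} → Word n → Word n → Bool
shadowCharacter y x = parity x xor ⟨ x , y ⟩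

IsShadowVector : ∀ {n} → Code n → Word n → Set
IsShadowVector C y = ∀ x → x ∈C C → ⟨ x , y ⟩ ≡ parity x

vanishesOn-shadowCharacter⇔ : ∀ {n} (C : Code n) y →
                              vanishesOn C (shadowCharacter y) ≡ true ⇔ IsShadowVector C y
vanishesOn-shadowCharacter⇔ C y = mk⇔
  (λ vanishes x x∈C → xor≡false⇒≡ (parity x) ⟨ x , y ⟩
     (not≡true⇒≡false (allW-⇒-sound C (λ x → not (shadowCharacter y x)) vanishes x x∈C)))
  (λ shadowVector → allW-⇒-intro C (λ x → not (shadowCharacter y x)) (λ x x∈C →
     ≡false⇒not≡true (trans (cong (parity x xor_) (shadowVector x x∈C)) (xor-same (parity x)))))

module _ {n : ℕ} {C : Code n} (selfDual : IsSelfDual C) where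

  codewords-orthogonal : ∀ x y → x ∈C C → y ∈C C → ⟨ x , y ⟩ ≡ false
  codewords-orthogonal x y x∈C y∈C = proj₁ (selfDual x) x∈C y y∈C

  orthogonal⇒∈ : ∀ y → (∀ x → x ∈C C → ⟨ x , y ⟩ ≡ false) → y ∈C C
  orthogonal⇒∈ y y⊥C = proj₂ (selfDual y) (λ x x∈C → trans (⟨⟩-comm y x) (y⊥C x x∈C))

  vanishesOn-⟨⟩ : ∀ y → vanishesOn C (λ x → ⟨ x , y ⟩) ≡ C y
  vanishesOn-⟨⟩ y = ⇔→≡ (mk⇔
    (λ vanishes → orthogonal⇒∈ y (λ x x∈C →
      not≡true⇒≡false (allW-⇒-sound C (λ x → not ⟨ x , y ⟩) vanishes x x∈C)))
    (λ y∈C → allW-⇒-intro C (λ x → not ⟨ x , y ⟩) (λ x x∈C →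
      ≡false⇒not≡true (codewords-orthogonal x y x∈C y∈C))))

  shadowCharacter-hom : ∀ y → IsHomomorphismOn C (shadowCharacter y)
  shadowCharacter-hom y x x′ x∈C x′∈C = begin
    parity (x ⊕ᵥ x′) xor ⟨ x ⊕ᵥ x′ , y ⟩
      ≡⟨ cong₂ _xor_ parity-sum (⟨⟩-linearˡ x x′ y) ⟩
    (parity x xor parity x′) xor (⟨ x , y ⟩ xor ⟨ x′ , y ⟩)
      ≡⟨ xor-interchange (parity x) (parity x′) ⟨ x , y ⟩ ⟨ x′ , y ⟩ ⟩
    (parity x xor ⟨ x , y ⟩) xor (parity x′ xor ⟨ x′ , y ⟩)
      ∎
    where
    open ≡-Reasoning
    parity-sum : parity (x ⊕ᵥ x′) ≡ parity x xor parity x′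
    parity-sum rewrite parity-⊕ᵥ x x′ | codewords-orthogonal x x′ x∈C x′∈C = xor-identityʳ _

  IsShadowVector⇔∈-even : isEvenCode C ≡ true → ∀ y → IsShadowVector C y ⇔ y ∈C C
  IsShadowVector⇔∈-even even y = mk⇔
    (λ shadowVector → orthogonal⇒∈ y (λ x x∈C → trans (shadowVector x x∈C) (codeword-even x x∈C)))
    (λ y∈C x x∈C → trans (codewords-orthogonal x y x∈C y∈C) (sym (codeword-even x x∈C)))
    where
    codeword-even : ∀ x → x ∈C C → parity x ≡ false
    codeword-even x x∈C = wt-even⇒parity≡false x (allW-⇒-sound C (λ x → isEven (wt x)) even x x∈C)

module _ {n : ℕ} {C : Code n} (linear : IsLinear C) (selfDual : IsSelfDual C) where
  open IsLinear linear

  card²≡4^n : card C * card C ≡ 4ℚ ^ n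
  card²≡4^n = begin
    card C * card C
      ≡⟨ sym (∑-*ˡ (card C) (λ y → if C y then 1ℚ else 0ℚ) (allWords n)) ⟩
    ∑ʷ (λ y → card C * (if C y then 1ℚ else 0ℚ))
      ≡⟨ ∑-cong (λ y → trans (*-if (card C) (C y) 1ℚ) (cong₂ (λ v q → if v then q else 0ℚ)
                       (sym (vanishesOn-⟨⟩ selfDual y)) (ℚ.*-identityʳ (card C)))) (allWords n) ⟩
    ∑ʷ (λ y → if vanishesOn C (λ x → ⟨ x , y ⟩) then card C else 0ℚ)
      ≡⟨ sym (∑-cong (λ y → character-sum linear (λ x x′ _ _ → ⟨⟩-linearˡ x x′ y)) (allWords n)) ⟩
    ∑ʷ (λ y → ∑ʷ (λ x → if C x then sign ⟨ x , y ⟩ else 0ℚ))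
      ≡⟨ sym (∑-comm (λ x y → if C x then sign ⟨ x , y ⟩ else 0ℚ) (allWords n) (allWords n)) ⟩
    ∑ʷ (λ x → ∑ʷ (λ y → if C x then sign ⟨ x , y ⟩ else 0ℚ))
      ≡⟨ ∑-cong column (allWords n) ⟩
    ∑ʷ (λ x → if C x then ∏ (δ𝟘 4ℚ) x else 0ℚ)
      ≡⟨ ∑ʷ-∏-δ𝟘 4ℚ C ⟩
    (if C 0ᵥ then 4ℚ ^ n else 0ℚ)
      ≡⟨ cong (λ v → if v then 4ℚ ^ n else 0ℚ) has-zero ⟩
    4ℚ ^ n
      ∎
    where
    open ≡-Reasoning
    ∑-sign-⟨⟩ : ∀ x → ∑ʷ (λ y → sign ⟨ x , y ⟩) ≡ ∏ (δ𝟘 4ℚ) x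
    ∑-sign-⟨⟩ x = begin
      ∑ʷ (λ y → sign ⟨ x , y ⟩)                 ≡⟨ ∑-cong (sign-⟨⟩ x) (allWords n) ⟩
      ∑ʷ (∏₂ (λ k l → sign (k · l)) x)          ≡⟨ ∑ʷ-∏₂ (λ k l → sign (k · l)) x ⟩
      ∏ (λ k → ∑K (λ l → sign (k · l))) x      ≡⟨ ∏-cong ∑K-sign-· x ⟩
      ∏ (δ𝟘 4ℚ) x                               ∎
    column : ∀ x → ∑ʷ (λ y → if C x then sign ⟨ x , y ⟩ else 0ℚ)
                 ≡ (if C x then ∏ (δ𝟘 4ℚ) x else 0ℚ)
    column x = trans (∑-if (C x) (λ y → sign ⟨ x , y ⟩) (allWords n))
                     (cong (λ q → if C x then q else 0ℚ) (∑-sign-⟨⟩ x))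

  card≡2^n : card C ≡ 2ℚ ^ n
  card≡2^n = square-injective (card C) (2ℚ ^ n) (∑-nonneg _ indicator≥0 (allWords n)) (2^n>0 n)
                              (trans card²≡4^n (4^n≡2^n*2^n n))
    where
    indicator≥0 : ∀ x → 0ℚ ≤ (if C x then 1ℚ else 0ℚ)
    indicator≥0 x with C x
    ... | true  = ℚ.nonNegative⁻¹ 1ℚ
    ... | false = ℚ.≤-refl

  -- y lies outside C = C⊥, so some codeword x₂ has ⟨ x₂ , y ⟩ = 1; x₂ is odd, and adding
  -- x₂ to an odd codeword gives an even one.
  orthogonal-to-even⇒IsShadowVector : ∀ y → C y ≡ false →
    (∀ z → z ∈C C → parity z ≡ false → ⟨ z , y ⟩ ≡ false) → IsShadowVector C y
  orthogonal-to-even⇒IsShadowVector y y∉C y⊥C₀ x x∈C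
    with allW-⇒-counterexample C (λ x → not ⟨ x , y ⟩) (trans (vanishesOn-⟨⟩ selfDual y) y∉C)
  ... | x₂ , x₂∈C , ¬⟨x₂,y⟩ with parity x in parity-x
  ...   | false = y⊥C₀ x x∈C parity-x
  ...   | true  =
    trans (sym (xor≡false⇒≡ ⟨ x , y ⟩ ⟨ x₂ , y ⟩ sum⊥y)) (not≡false⇒≡true ¬⟨x₂,y⟩)
    where
    x₂-odd : parity x₂ ≡ true
    x₂-odd with parity x₂ in parity-x₂
    ... | true  = refl
    ... | false with trans (sym (y⊥C₀ x₂ x₂∈C parity-x₂)) (not≡false⇒≡true ¬⟨x₂,y⟩)
    ...   | ()
    sum-even : parity (x ⊕ᵥ x₂) ≡ false
    sum-even rewrite parity-⊕ᵥ x x₂ | parity-x | x₂-odd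
                   | codewords-orthogonal selfDual x x₂ x∈C x₂∈C = refl
    sum⊥y : ⟨ x , y ⟩ xor ⟨ x₂ , y ⟩ ≡ false
    sum⊥y = trans (sym (⟨⟩-linearˡ x x₂ y)) (y⊥C₀ (x ⊕ᵥ x₂) (closed x x₂ x∈C x₂∈C) sum-even)

  IsShadowVector⇔∈-odd : isEvenCode C ≡ false → ∀ y →
                         IsShadowVector C y ⇔ (dual (evenSubcode C) y ∧ not (C y)) ≡ true
  IsShadowVector⇔∈-odd odd y with allW-⇒-counterexample C (λ x → isEven (wt x)) odd
  ... | x₁ , x₁∈C , x₁-odd = mk⇔
    (λ shadowVector →
      cong₂ _∧_ (∈-dual (evenSubcode C) y (⊥C₀ shadowVector)) (cong not (∉C shadowVector)))
    (λ y∈C′ → orthogonal-to-even⇒IsShadowVector y (not≡true⇒≡false (∧-conicalʳ _ _ y∈C′))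
      (λ z z∈C even-z → trans (⟨⟩-comm z y)
        (dual-orthogonal (evenSubcode C) y (∧-conicalˡ _ _ y∈C′) z
          (cong₂ _∧_ z∈C (trans (isEven-wt z) (cong not even-z))))))
    where
    ⊥C₀ : IsShadowVector C y → ∀ z → z ∈C evenSubcode C → ⟨ y , z ⟩ ≡ false
    ⊥C₀ shadowVector z z∈C₀ = trans (⟨⟩-comm y z) (trans (shadowVector z (∧-conicalˡ _ _ z∈C₀))
                                (wt-even⇒parity≡false z (∧-conicalʳ _ _ z∈C₀)))
    ∉C : IsShadowVector C y → C y ≡ false
    ∉C shadowVector with C y in y∈C
    ... | false = refl
    ... | true with trans (sym (wt-odd⇒parity≡true x₁ x₁-odd))
      (trans (sym (shadowVector x₁ x₁∈C)) (codewords-orthogonal selfDual x₁ y x₁∈C y∈C))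
    ...   | ()

  vanishesOn-shadowCharacter : ∀ y → vanishesOn C (shadowCharacter y) ≡ shadow C y
  vanishesOn-shadowCharacter y = by-parity-of-C (isEvenCode C) refl
    where
    by-parity-of-C : ∀ e → isEvenCode C ≡ e →
      vanishesOn C (shadowCharacter y) ≡ (if e then C y else (dual (evenSubcode C) y ∧ not (C y)))
    by-parity-of-C true  even =
      ⇔→≡ (⇔-trans (vanishesOn-shadowCharacter⇔ C y) (IsShadowVector⇔∈-even selfDual even y))
    by-parity-of-C false odd  =
      ⇔→≡ (⇔-trans (vanishesOn-shadowCharacter⇔ C y) (IsShadowVector⇔∈-odd odd y))

-- The shadow transform

monomial : ℚ → ℚ → K → ℚ
monomial u v 𝟘 = u
monomial u v a = v
monomial u v b = v
monomial u v c = v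

ũ ṽ : ℚ → ℚ → ℚ
ũ u v = ½ * (u + 3ℚ * v)
ṽ u v = ½ * (v - u)

monomial-transform : ∀ k u v →
  monomial (ũ u v) (ṽ u v) k ≡ ½ * ∑K (λ l → sign (nonzero k xor (k · l)) * monomial u v l)
monomial-transform 𝟘 = identity
  where
  identity : ∀ u v → ½ * (u + 3ℚ * v) ≡ ½ * (1ℚ * u + (1ℚ * v + (1ℚ * v + (1ℚ * v + 0ℚ))))
  identity = solve 2 (λ u v →
      con ½ :* (u :+ con 3ℚ :* v)
      := con ½ :* (con 1ℚ :* u :+ (con 1ℚ :* v :+ (con 1ℚ :* v :+ (con 1ℚ :* v :+ con 0ℚ))))) refl
monomial-transform a = identity
  where
  identity : ∀ u v → ½ * (v - u) ≡ ½ * (- 1ℚ * u + (- 1ℚ * v + (1ℚ * v + (1ℚ * v + 0ℚ))))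
  identity = solve 2 (λ u v →
      con ½ :* (v :- u)
      := con ½ :* (con (- 1ℚ) :* u :+ (con (- 1ℚ) :* v :+ (con 1ℚ :* v :+ (con 1ℚ :* v :+ con 0ℚ))))) refl
monomial-transform b = identity
  where
  identity : ∀ u v → ½ * (v - u) ≡ ½ * (- 1ℚ * u + (1ℚ * v + (- 1ℚ * v + (1ℚ * v + 0ℚ))))
  identity = solve 2 (λ u v →
      con ½ :* (v :- u)
      := con ½ :* (con (- 1ℚ) :* u :+ (con 1ℚ :* v :+ (con (- 1ℚ) :* v :+ (con 1ℚ :* v :+ con 0ℚ))))) refl
monomial-transform c = identity
  where
  identity : ∀ u v → ½ * (v - u) ≡ ½ * (- 1ℚ * u + (1ℚ * v + (1ℚ * v + (- 1ℚ * v + 0ℚ))))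
  identity = solve 2 (λ u v →
      con ½ :* (v :- u)
      := con ½ :* (con (- 1ℚ) :* u :+ (con 1ℚ :* v :+ (con 1ℚ :* v :+ (con (- 1ℚ) :* v :+ con 0ℚ))))) refl

monomial-product : ∀ {n} u v (x : Word n) → u ^ (n ∸ wt x) * v ^ wt x ≡ ∏ (monomial u v) x
monomial-product u v [] = refl
monomial-product {suc n} u v (𝟘 ∷ x) = begin
  u ^ (suc n ∸ wt x) * v ^ wt x      ≡⟨ cong (λ m → u ^ m * v ^ wt x) (ℕ.+-∸-assoc 1 (wt≤n x)) ⟩
  u * u ^ (n ∸ wt x) * v ^ wt x      ≡⟨ ℚ.*-assoc u _ _ ⟩
  u * (u ^ (n ∸ wt x) * v ^ wt x)    ≡⟨ cong (u *_) (monomial-product u v x) ⟩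
  u * ∏ (monomial u v) x             ∎
  where open ≡-Reasoning
monomial-product {suc n} u v (a ∷ x) =
  trans (x∙yz≈y∙xz (u ^ (n ∸ wt x)) v (v ^ wt x)) (cong (v *_) (monomial-product u v x))
monomial-product {suc n} u v (b ∷ x) =
  trans (x∙yz≈y∙xz (u ^ (n ∸ wt x)) v (v ^ wt x)) (cong (v *_) (monomial-product u v x))
monomial-product {suc n} u v (c ∷ x) =
  trans (x∙yz≈y∙xz (u ^ (n ∸ wt x)) v (v ^ wt x)) (cong (v *_) (monomial-product u v x))

∏₂-signed-monomial : ∀ {n} u v (x y : Word n) →
  ∏₂ (λ k l → sign (nonzero k xor (k · l)) * monomial u v l) x y
    ≡ sign (shadowCharacter y x) * ∏ (monomial u v) y
∏₂-signed-monomial u v []      []      = refl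
∏₂-signed-monomial u v (k ∷ x) (l ∷ y) = begin
  s₁ * m * ∏₂ (λ k l → sign (nonzero k xor (k · l)) * monomial u v l) x y
    ≡⟨ cong (s₁ * m *_) (∏₂-signed-monomial u v x y) ⟩
  s₁ * m * (sign (shadowCharacter y x) * ∏ (monomial u v) y)
    ≡⟨ *-interchange s₁ m (sign (shadowCharacter y x)) (∏ (monomial u v) y) ⟩
  s₁ * sign (shadowCharacter y x) * (m * ∏ (monomial u v) y)
    ≡⟨ cong (_* (m * ∏ (monomial u v) y)) (sym (sign-xor (nonzero k xor (k · l)) (shadowCharacter y x))) ⟩
  sign ((nonzero k xor (k · l)) xor (parity x xor ⟨ x , y ⟩)) * (m * ∏ (monomial u v) y)
    ≡⟨ cong (λ s → sign s * (m * ∏ (monomial u v) y))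
            (xor-interchange (nonzero k) (k · l) (parity x) ⟨ x , y ⟩) ⟩
  sign ((nonzero k xor parity x) xor ((k · l) xor ⟨ x , y ⟩)) * (m * ∏ (monomial u v) y)
    ∎
  where
  open ≡-Reasoning
  s₁ m : ℚ
  s₁ = sign (nonzero k xor (k · l))
  m  = monomial u v l

transformed-monomial : ∀ {n} u v (x : Word n) →
  ũ u v ^ (n ∸ wt x) * ṽ u v ^ wt x
    ≡ ½ ^ n * ∑ʷ (λ y → sign (shadowCharacter y x) * ∏ (monomial u v) y)
transformed-monomial {n} u v x = begin
  ũ u v ^ (n ∸ wt x) * ṽ u v ^ wt x
    ≡⟨ monomial-product (ũ u v) (ṽ u v) x ⟩
  ∏ (monomial (ũ u v) (ṽ u v)) x
    ≡⟨ ∏-cong (λ k → monomial-transform k u v) x ⟩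
  ∏ (λ k → ½ * ∑K (g k)) x
    ≡⟨ ∏-scale ½ (λ k → ∑K (g k)) x ⟩
  ½ ^ n * ∏ (λ k → ∑K (g k)) x
    ≡⟨ cong (½ ^ n *_) (sym (∑ʷ-∏₂ g x)) ⟩
  ½ ^ n * ∑ʷ (∏₂ g x)
    ≡⟨ cong (½ ^ n *_) (∑-cong (∏₂-signed-monomial u v x) (allWords n)) ⟩
  ½ ^ n * ∑ʷ (λ y → sign (shadowCharacter y x) * ∏ (monomial u v) y)
    ∎
  where
  open ≡-Reasoning
  g : K → K → ℚ
  g k l = sign (nonzero k xor (k · l)) * monomial u v l

W-shadow : ∀ {n} {C : Code n} → IsLinear C → IsSelfDual C →
           ∀ u v → W C (ũ u v) (ṽ u v) ≡ W (shadow C) u v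
W-shadow {n} {C} linear selfDual u v = begin
  ∑ʷ (λ x → if C x then ũ u v ^ (n ∸ wt x) * ṽ u v ^ wt x else 0ℚ)
    ≡⟨ ∑-cong expand (allWords n) ⟩
  ∑ʷ (λ x → ½ ^ n * ∑ʷ (λ y → if C x then sign (χ y x) * M y else 0ℚ))
    ≡⟨ ∑-*ˡ (½ ^ n) (λ x → ∑ʷ (λ y → if C x then sign (χ y x) * M y else 0ℚ)) (allWords n) ⟩
  ½ ^ n * ∑ʷ (λ x → ∑ʷ (λ y → if C x then sign (χ y x) * M y else 0ℚ))
    ≡⟨ cong (½ ^ n *_)
            (∑-comm (λ x y → if C x then sign (χ y x) * M y else 0ℚ) (allWords n) (allWords n)) ⟩
  ½ ^ n * ∑ʷ (λ y → ∑ʷ (λ x → if C x then sign (χ y x) * M y else 0ℚ))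
    ≡⟨ cong (½ ^ n *_) (∑-cong orthogonality (allWords n)) ⟩
  ½ ^ n * ∑ʷ (λ y → card C * (if shadow C y then M y else 0ℚ))
    ≡⟨ cong (½ ^ n *_) (∑-*ˡ (card C) (λ y → if shadow C y then M y else 0ℚ) (allWords n)) ⟩
  ½ ^ n * (card C * W′)
    ≡⟨ cong (λ N → ½ ^ n * (N * W′)) (card≡2^n linear selfDual) ⟩
  ½ ^ n * (2ℚ ^ n * W′)
    ≡⟨ ½^n*[2^n*q]≡q n W′ ⟩
  ∑ʷ (λ y → if shadow C y then M y else 0ℚ)
    ≡⟨ ∑-cong (λ y → cong (λ q → if shadow C y then q else 0ℚ) (sym (monomial-product u v y)))
              (allWords n) ⟩
  ∑ʷ (λ y → if shadow C y then u ^ (n ∸ wt y) * v ^ wt y else 0ℚ)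
    ∎
  where
  open ≡-Reasoning
  χ : Word n → Word n → Bool
  χ = shadowCharacter
  M : Word n → ℚ
  M = ∏ (monomial u v)
  W′ : ℚ
  W′ = ∑ʷ (λ y → if shadow C y then M y else 0ℚ)
  expand : ∀ x → (if C x then ũ u v ^ (n ∸ wt x) * ṽ u v ^ wt x else 0ℚ)
               ≡ ½ ^ n * ∑ʷ (λ y → if C x then sign (χ y x) * M y else 0ℚ)
  expand x = begin
    (if C x then ũ u v ^ (n ∸ wt x) * ṽ u v ^ wt x else 0ℚ)
      ≡⟨ cong (λ q → if C x then q else 0ℚ) (transformed-monomial u v x) ⟩
    (if C x then ½ ^ n * ∑ʷ (λ y → sign (χ y x) * M y) else 0ℚ)
      ≡⟨ sym (*-if (½ ^ n) (C x) _) ⟩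
    ½ ^ n * (if C x then ∑ʷ (λ y → sign (χ y x) * M y) else 0ℚ)
      ≡⟨ cong (½ ^ n *_) (sym (∑-if (C x) (λ y → sign (χ y x) * M y) (allWords n))) ⟩
    ½ ^ n * ∑ʷ (λ y → if C x then sign (χ y x) * M y else 0ℚ)
      ∎
  orthogonality : ∀ y → ∑ʷ (λ x → if C x then sign (χ y x) * M y else 0ℚ)
                      ≡ card C * (if shadow C y then M y else 0ℚ)
  orthogonality y = begin
    ∑ʷ (λ x → if C x then sign (χ y x) * M y else 0ℚ)
      ≡⟨ ∑-cong (λ x → if-*-comm (C x) (sign (χ y x)) (M y)) (allWords n) ⟩
    ∑ʷ (λ x → M y * (if C x then sign (χ y x) else 0ℚ))
      ≡⟨ ∑-*ˡ (M y) (λ x → if C x then sign (χ y x) else 0ℚ) (allWords n) ⟩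
    M y * ∑ʷ (λ x → if C x then sign (χ y x) else 0ℚ)
      ≡⟨ cong (M y *_) (character-sum linear (shadowCharacter-hom selfDual y)) ⟩
    M y * (if vanishesOn C (χ y) then card C else 0ℚ)
      ≡⟨ cong (λ s → M y * (if s then card C else 0ℚ)) (vanishesOn-shadowCharacter linear selfDual y) ⟩
    M y * (if shadow C y then card C else 0ℚ)
      ≡⟨ trans (*-if (M y) (shadow C y) (card C)) (if-*-comm (shadow C y) (M y) (card C)) ⟩
    card C * (if shadow C y then M y else 0ℚ)
      ∎

Wγ₁-transform : ∀ u v → Wγ₁ (ũ u v) (ṽ u v) ≡ Wγ₁' u v
Wγ₁-transform = identity
  where
  identity : ∀ u v → ½ * (u + 3ℚ * v) + ½ * (v - u) ≡ 2ℚ * v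
  identity = solve 2 (λ u v → con ½ :* (u :+ con 3ℚ :* v) :+ con ½ :* (v :- u) := con 2ℚ :* v) refl

Wε₂-transform : ∀ u v → Wε₂ (ũ u v) (ṽ u v) ≡ Wε₂ u v
Wε₂-transform = identity
  where
  identity : ∀ u v → ½ * (u + 3ℚ * v) * (½ * (u + 3ℚ * v) * 1ℚ)
                     + 3ℚ * (½ * (v - u) * (½ * (v - u) * 1ℚ))
                   ≡ u * (u * 1ℚ) + 3ℚ * (v * (v * 1ℚ))
  identity = solve 2 (λ u v →
      con ½ :* (u :+ con 3ℚ :* v) :* (con ½ :* (u :+ con 3ℚ :* v) :* con 1ℚ)
        :+ con 3ℚ :* (con ½ :* (v :- u) :* (con ½ :* (v :- u) :* con 1ℚ))
      := u :* (u :* con 1ℚ) :+ con 3ℚ :* (v :* (v :* con 1ℚ))) refl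

Wγ₁²-transform : ∀ u v → Wγ₁² (ũ u v) (ṽ u v) ≡ Wγ₁'² u v
Wγ₁²-transform u v = trans (cong (_^ 2) (Wγ₁-transform u v)) (identity v)
  where
  identity : ∀ v → 2ℚ * v * (2ℚ * v * 1ℚ) ≡ 4ℚ * (v * (v * 1ℚ))
  identity = solve 1 (λ v →
      con 2ℚ :* v :* (con 2ℚ :* v :* con 1ℚ)
      := con 4ℚ :* (v :* (v :* con 1ℚ))) refl

lemma1 : (n : ℕ) (C : Code n) → IsLinear C → IsSelfDual C →
         (d e : ℕ) (P Q : Poly2) →
         IsWeightedHomogeneous d P → IsWeightedHomogeneous e Q →
         (∀ u v → W C u v ≡ eval P (Wγ₁ u v) (Wε₂ u v)) →
         (∀ u v → W C u v ≡ eval Q (Wγ₁ u v) (Wε₂ u v - Wγ₁² u v)) →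
         (∀ u v → W (shadow C) u v ≡ eval P (Wγ₁' u v) (Wε₂ u v))
         × (∀ u v → W (shadow C) u v ≡ eval Q (Wγ₁' u v) (Wε₂ u v - Wγ₁'² u v))
lemma1 n C linear selfDual _ _ P Q _ _ W≡P W≡Q = via-P , via-Q
  where
  open ≡-Reasoning
  via-P : ∀ u v → W (shadow C) u v ≡ eval P (Wγ₁' u v) (Wε₂ u v)
  via-P u v = begin
    W (shadow C) u v
      ≡⟨ sym (W-shadow linear selfDual u v) ⟩
    W C (ũ u v) (ṽ u v)
      ≡⟨ W≡P (ũ u v) (ṽ u v) ⟩
    eval P (Wγ₁ (ũ u v) (ṽ u v)) (Wε₂ (ũ u v) (ṽ u v))
      ≡⟨ cong₂ (eval P) (Wγ₁-transform u v) (Wε₂-transform u v) ⟩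
    eval P (Wγ₁' u v) (Wε₂ u v)
      ∎
  via-Q : ∀ u v → W (shadow C) u v ≡ eval Q (Wγ₁' u v) (Wε₂ u v - Wγ₁'² u v)
  via-Q u v = begin
    W (shadow C) u v
      ≡⟨ sym (W-shadow linear selfDual u v) ⟩
    W C (ũ u v) (ṽ u v)
      ≡⟨ W≡Q (ũ u v) (ṽ u v) ⟩
    eval Q (Wγ₁ (ũ u v) (ṽ u v)) (Wε₂ (ũ u v) (ṽ u v) - Wγ₁² (ũ u v) (ṽ u v))
      ≡⟨ cong₂ (eval Q) (Wγ₁-transform u v) (cong₂ _-_ (Wε₂-transform u v) (Wγ₁²-transform u v)) ⟩
    eval Q (Wγ₁' u v) (Wε₂ u v - Wγ₁'² u v)
      ∎
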